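{- Let $\mathcal{T}$ be a set of binary phylogenetic $X$-trees and $S\circ S'$ a tree-child cherry picking sequence for $\mathcal{T}$, where $S$ is a prefix. Suppose that $S\circ S'$ is dominated by $S\circ\langle (x,y)\rangle$ for some pair $(x,y)\in X\times X$. Then there exists a tree-child cherry picking sequence $S\circ\langle (x,y)\rangle\circ S''$ for $\mathcal{T}$ with $w(S\circ\langle (x,y)\rangle\circ S'')\le w(S\circ S')$.
   Context: A binary phylogenetic $X'$-tree is a rooted tree whose root has out-degree 2, whose internal non-root nodes have in-degree 1 and out-degree 2, and whose leaves are bijectively labelled by $X'$ (or a single node if $|X'|=1$). A pair $\{x,y\}$ is a cherry of a tree if leaves $x,y$ are siblings. A cherry picking sequence is a sequence $\langle (x_1,y_1),\dots,(x_r,y_r),(x_{r+1},-),\dots,(x_s,-)\rangle$ with $x_i,y_i\in X$, of length $s$; it is tree-child if $s\le r+1$ and $y_j\ne x_i$ for all $1\le i<j\le s$. $S_{i,j}$ denotes the subsequence of the $i$th through $j$th elements (empty if $j<i$); $\circ$ denotes concatenation. Applying a sequence to a tree $T$: successively, for each pair $(a,b)$, if $\{a,b\}$ is a cherry of the current tree, delete leaf $a$ and suppress the parent of $b$, otherwise do nothing; $T/S$ is the result, $\mathcal{T}/S=\{T/S:T\in\mathcal{T}\}$. A sequence $S$ is a cherry picking sequence for $\mathcal{T}$ if $s>r$, $\{x_1,\dots,x_s\}=X$, and each $T/S$ is a single leaf in $\{x_{r+1},\dots,x_s\}$. Weight: $w(S)=s-|X|$. $c_{x,y}(\mathcal{T}/S)$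 is the number of trees in $\mathcal{T}/S$ with $\{x,y\}$ as a cherry. An extension $S\circ S'$ of $S$ is dominated by $S\circ\langle (x,y)\rangle$ if there is an index $j>1$ such that: $(x,y)$ is the $j$th element of $S'$; $c_{x,y}(\mathcal{T}/S)=c_{x,y}(\mathcal{T}/(S\circ S'_{1,j-1}))$; and every pair $(x',y')$ in $S'_{1,j-1}$ satisfies $y'\ne x$ and $\{x',y'\}\ne\{x,y\}$. -}

module Defs where

open import Data.Nat using (ℕ; suc; _≤_; _<_)
open import Data.Integer using (ℤ; _⊖_)
open import Data.Fin using (Fin; toℕ; _≟_)
open import Data.Bool using (Bool; true; false; if_then_else_; _∧_; _∨_)
open import Data.Maybe using (Maybe; just; nothing)
open import Data.Product using (Σ; _×_; _,_; proj₁; proj₂; ∃; ∃-syntax)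
open import Data.List using (List; []; _∷_; _++_; map; length; filter; lookup)
open import Data.List.Membership.Propositional using (_∈_)
open import Data.List.Relation.Unary.Unique.Propositional using (Unique)
open import Relation.Nullary using (¬_; does)
open import Relation.Binary.PropositionalEquality using (_≡_; _≢_)

module _ {n : ℕ} where

  -- Labels: the leaf set X is Fin n (so |X| = n).
  -- Rooted binary trees (every internal node has exactly two children);
  -- the order of children is irrelevant for all notions below.
  data Tree : Set where
    leaf : Fin n → Tree
    node : Tree → Tree → Tree

  leaves : Tree → List (Fin n)
  leaves (leaf a)   = a ∷ []
  leaves (node l r) = leaves l ++ leaves r

  IsPhyloXTree : Tree → Set
  IsPhyloXTree T = Unique (leaves T) × (∀ (a : Fin n) → a ∈ leaves T)

  _==_ : Fin n → Fin n → Bool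
  a == b = does (a ≟ b)

  isCherry : Fin n → Fin n → Tree → Bool
  isCherry a b (leaf _) = false
  isCherry a b (node (leaf u) (leaf v)) = ((u == a) ∧ (v == b)) ∨ ((u == b) ∧ (v == a))
  isCherry a b (node l r) = isCherry a b l ∨ isCherry a b r

  -- pick (a,b): if {a,b} is a cherry, delete leaf a and suppress the parent of b
  -- (the cherry node is replaced by the leaf b); otherwise nothing changes.
  pick : Fin n → Fin n → Tree → Tree
  pick a b (leaf z) = leaf z
  pick a b (node (leaf u) (leaf v)) =
    if ((u == a) ∧ (v == b)) ∨ ((u == b) ∧ (v == a)) then leaf b else node (leaf u) (leaf v)
  pick a b (node l r) = node (pick a b l) (pick a b r)

  -- An element of a sequence: (x , just y) is the pair (x,y); (x , nothing) is (x,-).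
  Elem : Set
  Elem = Fin n × Maybe (Fin n)

  Seq : Set
  Seq = List Elem

  pairE : Fin n × Fin n → Elem
  pairE (x , y) = x , just y

  singleE : Fin n → Elem
  singleE x = x , nothing

  apply : Seq → Tree → Tree
  apply [] T = T
  apply ((a , just b) ∷ S) T = apply S (pick a b T)
  apply ((a , nothing) ∷ S) T = apply S T

  applyAll : Seq → List Tree → List Tree
  applyAll S 𝒯 = map (apply S) 𝒯

  count : Fin n → Fin n → List Tree → ℕ
  count x y 𝒯 = length (filter (λ T → isCherry x y T ≡? true) 𝒯)
    where
      open import Data.Bool.Properties using () renaming (_≟_ to _≡?_)

  Shape : Seq → List (Fin n × Fin n) → List (Fin n) → Set
  Shape S ps qs = S ≡ map pairE ps ++ map singleE qs

  TreeChild : Seq → Set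
  TreeChild S =
    Σ (List (Fin n × Fin n)) λ ps → Σ (List (Fin n)) λ qs →
      Shape S ps qs × length S ≤ suc (length ps) ×
      (∀ (i j : Fin (length S)) → toℕ i < toℕ j →
         proj₂ (lookup S j) ≢ just (proj₁ (lookup S i)))

  IsCPS : List Tree → Seq → Set
  IsCPS 𝒯 S =
    Σ (List (Fin n × Fin n)) λ ps → Σ (List (Fin n)) λ qs →
      Shape S ps qs × length ps < length S ×
      (∀ (a : Fin n) → a ∈ map proj₁ S) ×
      (∀ T → T ∈ 𝒯 → ∃[ z ] (apply S T ≡ leaf z × z ∈ qs))

  weight : Seq → ℤ
  weight S = length S ⊖ n

  Dominated : List Tree → Seq → Seq → Fin n → Fin n → Set
  Dominated 𝒯 S S' x y =
    Σ Seq λ pre → Σ Seq λ post →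
      S' ≡ pre ++ (x , just y) ∷ post ×
      1 ≤ length pre ×
      count x y (applyAll S 𝒯) ≡ count x y (applyAll (S ++ pre) 𝒯) ×
      (∀ x' y' → (x' , just y') ∈ pre →
         y' ≢ x × ¬ (x' ≡ x × y' ≡ y) × ¬ (x' ≡ y × y' ≡ x))

-- Write S' = P ∘ ⟨(x,y)⟩ ∘ Q and take S'' = P ∘ Q.  The new sequence is a permutation of the
-- old one moving a pair across pairs only, so its length, its shape and the tree-child
-- property survive (no pair of P has x as second component).  It remains to see that every
-- tree T is still reduced to the same leaf; let U = T/S.  If {x,y} is not a cherry of U, it
-- is not one of U/P either: pairs of P never destroy the cherry {x,y}, so a new one would
-- raise c_{x,y}.  Then (x,y) acts trivially in both orders.  If it is, then at every later
-- stage the tree produced by the new sequence is the old one with some subtrees pruned, all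
-- of whose leaves are first components of pairs already applied; such labels never
-- reappear as second components, so the final leaf cannot be among them.
module Submission where

open import Defs
open import Data.Nat using (ℕ; suc; s≤s; z≤n; _<_) renaming (_≤_ to _≤ℕ_)
open import Data.Nat.Properties using (≤-trans; n≤1+n; <-irrefl; suc-injective)
open import Data.Fin as Fin using (Fin; toℕ; _≟_)
open import Data.Bool using (true; false; if_then_else_)
import Data.Bool.Properties as Bool
open import Data.Maybe using (just; nothing)
open import Data.Maybe.Properties using (just-injective)
open import Data.Product using (Σ; ∃; ∃₂; _×_; _,_; proj₁; proj₂)
open import Data.Sum using (_⊎_; inj₁; inj₂; [_,_]′)
open import Data.Empty using (⊥-elim)
open import Data.Unit using (⊤)
open import Data.List using (List; []; _∷_; _++_; map; length; filter; lookup)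
open import Data.List.Properties using (∷-injective)
open import Data.List.Membership.Propositional using (_∈_; _∉_)
open import Data.List.Membership.Propositional.Properties using (∈-++⁺ˡ; ∈-++⁺ʳ; ∈-++⁻; ∈-map⁻; ∈-lookup)
open import Data.List.Relation.Unary.Any using (here; there; index)
open import Data.List.Relation.Unary.Any.Properties using (lookup-index)
open import Data.List.Relation.Unary.All as All using (All; []; _∷_)
import Data.List.Relation.Unary.All.Properties as All
open import Data.List.Relation.Unary.AllPairs as AllPairs using (AllPairs; []; _∷_)
open import Data.List.Relation.Unary.Unique.Propositional using (Unique)
open import Data.List.Relation.Binary.Disjoint.Propositional using (Disjoint)
open import Data.List.Relation.Binary.Subset.Propositional using (_⊆_)
open import Data.List.Relation.Binary.Subset.Propositional.Properties using (++⁺)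
open import Data.List.Relation.Binary.Permutation.Propositional using (_↭_)
open import Data.List.Relation.Binary.Permutation.Propositional.Properties as ↭
  using (shift; ++⁺ˡ; ↭-length; ∈-resp-↭; All-resp-↭)
open import Data.Integer using (_≤_; _⊖_)
open import Data.Integer.Properties using (≤-reflexive)
open import Function using (_∘_; id)
open import Relation.Unary using (Pred; Decidable)
open import Level using (0ℓ)
open import Relation.Binary using (Rel)
open import Relation.Nullary using (¬_; Dec; yes; no; does; _because_; proof; _×-dec_; _⊎-dec_)
open import Relation.Nullary.Reflects using (Reflects; ofʸ; ofⁿ; _⊎-reflects_; invert)
open import Relation.Binary.PropositionalEquality

module _ {a ℓ} {A : Set a} {R : Rel A ℓ} where

  AllPairs-++⁻ : ∀ xs {ys} → AllPairs R (xs ++ ys) →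
    AllPairs R xs × AllPairs R ys × All (λ x → All (R x) ys) xs
  AllPairs-++⁻ []       rys          = [] , rys , []
  AllPairs-++⁻ (x ∷ xs) (rx ∷ rxsys) with AllPairs-++⁻ xs rxsys
  ... | rxs , rys , cross = All.++⁻ˡ xs rx ∷ rxs , rys , All.++⁻ʳ xs rx ∷ cross

  AllPairs-hoist : ∀ xs ys {x zs} → All (R x) ys →
    AllPairs R (xs ++ ys ++ x ∷ zs) → AllPairs R (xs ++ x ∷ ys ++ zs)
  AllPairs-hoist []       []       _          rs          = rs
  AllPairs-hoist []       (y ∷ ys) (rxy ∷ rx) (ry ∷ rs)   with AllPairs-hoist [] ys rx rs
  ... | rxys ∷ rys = (rxy ∷ rxys) ∷ All.tail (All-resp-↭ (shift _ ys _) ry) ∷ rys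
  AllPairs-hoist (w ∷ xs) ys       rx         (rw ∷ rs)   =
    All-resp-↭ (++⁺ˡ xs (shift _ ys _)) rw ∷ AllPairs-hoist xs ys rx rs

  lookup⇒AllPairs : ∀ xs → (∀ i j → toℕ i < toℕ j → R (lookup xs i) (lookup xs j)) →
    AllPairs R xs
  lookup⇒AllPairs []       _ = []
  lookup⇒AllPairs (x ∷ xs) r =
    All.tabulate (λ y∈xs →
      subst (R x) (sym (lookup-index y∈xs)) (r Fin.zero (Fin.suc (index y∈xs)) (s≤s z≤n)))
    ∷ lookup⇒AllPairs xs (λ i j i<j → r (Fin.suc i) (Fin.suc j) (s≤s i<j))

  AllPairs⇒lookup : ∀ {xs} → AllPairs R xs →
    ∀ i j → toℕ i < toℕ j → R (lookup xs i) (lookup xs j)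
  AllPairs⇒lookup (rx ∷ _)  Fin.zero    (Fin.suc j) _         = All.lookup rx (∈-lookup j)
  AllPairs⇒lookup (_ ∷ rxs) (Fin.suc i) (Fin.suc j) (s≤s i<j) = AllPairs⇒lookup rxs i j i<j

Reflects-map : ∀ {a b} {A : Set a} {B : Set b} {β} → (A → B) → (B → A) → Reflects A β → Reflects B β
Reflects-map f g (ofʸ x)  = ofʸ (f x)
Reflects-map f g (ofⁿ ¬x) = ofⁿ (¬x ∘ g)

module _ {a b p} {A : Set a} {B : Set b} {P : Pred B p} (P? : Decidable P) (f g : A → B) where

  private
    #f #g : List A → ℕ
    #f xs = length (filter P? (map f xs))
    #g xs = length (filter P? (map g xs))

  filter-map-length-mono : ∀ xs → (∀ {x} → x ∈ xs → P (f x) → P (g x)) → #f xs ≤ℕ #g xs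
  filter-map-length-mono []       _   = z≤n
  filter-map-length-mono (x ∷ xs) f⇒g with P? (f x) | P? (g x)
  ... | yes _  | yes _  = s≤s (filter-map-length-mono xs (f⇒g ∘ there))
  ... | yes px | no ¬px = ⊥-elim (¬px (f⇒g (here refl) px))
  ... | no _   | yes _  = ≤-trans (filter-map-length-mono xs (f⇒g ∘ there)) (n≤1+n _)
  ... | no _   | no _   = filter-map-length-mono xs (f⇒g ∘ there)

  filter-map-length-≡⇒⊇ : ∀ xs → (∀ {x} → x ∈ xs → P (f x) → P (g x)) → #f xs ≡ #g xs →
    ∀ {x} → x ∈ xs → P (g x) → P (f x)
  filter-map-length-≡⇒⊇ (x ∷ xs) f⇒g eq x∈ pgx with P? (f x) | P? (g x)
  ... | yes px | no ¬px = ⊥-elim (¬px (f⇒g (here refl) px))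
  ... | no _   | yes _  = ⊥-elim (<-irrefl eq (s≤s (filter-map-length-mono xs (f⇒g ∘ there))))
  filter-map-length-≡⇒⊇ (x ∷ xs) f⇒g eq (here refl) pgx | yes pfx | yes _   = pfx
  filter-map-length-≡⇒⊇ (x ∷ xs) f⇒g eq (there m)   pgx | yes _   | yes _   =
    filter-map-length-≡⇒⊇ xs (f⇒g ∘ there) (suc-injective eq) m pgx
  filter-map-length-≡⇒⊇ (x ∷ xs) f⇒g eq (here refl) pgx | no _    | no ¬pgx = ⊥-elim (¬pgx pgx)
  filter-map-length-≡⇒⊇ (x ∷ xs) f⇒g eq (there m)   pgx | no _    | no _    =
    filter-map-length-≡⇒⊇ xs (f⇒g ∘ there) eq m pgx

module _ {n : ℕ} where

  private
    variable
      a b u v x y z : Fin n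
      F : List (Fin n)
      l l′ r r′ s t t′ t″ : Tree {n}

  Siblings : (a b u v : Fin n) → Set
  Siblings a b u v = (u ≡ a × v ≡ b) ⊎ (u ≡ b × v ≡ a)

  siblings? : ∀ a b u v → Dec (Siblings a b u v)
  siblings? a b u v = (u ≟ a ×-dec v ≟ b) ⊎-dec (u ≟ b ×-dec v ≟ a)

  Siblings-trans : Siblings x y u v → Siblings a b u v → Siblings x y a b
  Siblings-trans (inj₁ (refl , refl)) (inj₁ (refl , refl)) = inj₁ (refl , refl)
  Siblings-trans (inj₁ (refl , refl)) (inj₂ (refl , refl)) = inj₂ (refl , refl)
  Siblings-trans (inj₂ (refl , refl)) (inj₁ (refl , refl)) = inj₂ (refl , refl)
  Siblings-trans (inj₂ (refl , refl)) (inj₂ (refl , refl)) = inj₁ (refl , refl)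

  data Cherry (a b : Fin n) : Tree {n} → Set where
    cherry : Siblings a b u v → Cherry a b (node (leaf u) (leaf v))
    left   : Cherry a b l → Cherry a b (node l r)
    right  : Cherry a b r → Cherry a b (node l r)

  isCherry-reflects : ∀ a b t → Reflects (Cherry a b t) (isCherry a b t)
  isCherry-reflects a b (leaf _)                   = ofⁿ λ ()
  isCherry-reflects a b (node (leaf u) (leaf v))   =
    Reflects-map cherry (λ { (cherry s) → s }) (proof (siblings? a b u v))
  isCherry-reflects a b (node (leaf u) (node l r)) =
    Reflects-map right (λ { (left ()) ; (right c) → c }) (isCherry-reflects a b (node l r))
  isCherry-reflects a b (node (node l₁ l₂) r)      =
    Reflects-map [ left , right ]′ (λ { (left c) → inj₁ c ; (right c) → inj₂ c })
      (isCherry-reflects a b (node l₁ l₂) ⊎-reflects isCherry-reflects a b r)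

  cherry? : ∀ a b t → Dec (Cherry a b t)
  cherry? a b t = isCherry a b t because isCherry-reflects a b t

  isCherry⇒Cherry : isCherry a b t ≡ true → Cherry a b t
  isCherry⇒Cherry {a} {b} {t} eq = invert (subst (Reflects _) eq (isCherry-reflects a b t))

  Cherry⇒isCherry : Cherry a b t → isCherry a b t ≡ true
  Cherry⇒isCherry {a} {b} {t} c with isCherry a b t | isCherry-reflects a b t
  ... | true  | _      = refl
  ... | false | ofⁿ ¬c = ⊥-elim (¬c c)

  Cherry⇒∈leaves : Cherry a b t → a ∈ leaves t
  Cherry⇒∈leaves (cherry (inj₁ (refl , refl))) = here refl
  Cherry⇒∈leaves (cherry (inj₂ (refl , refl))) = there (here refl)
  Cherry⇒∈leaves (left c)                      = ∈-++⁺ˡ (Cherry⇒∈leaves c)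
  Cherry⇒∈leaves {t = node l _} (right c)      = ∈-++⁺ʳ (leaves l) (Cherry⇒∈leaves c)

  data Picks (a b : Fin n) : Tree {n} → Tree {n} → Set where
    leaf   : Picks a b (leaf z) (leaf z)
    cherry : Siblings a b u v → Picks a b (node (leaf u) (leaf v)) (leaf b)
    node   : (∀ {u v} → l ≡ leaf u → r ≡ leaf v → ¬ Siblings a b u v) →
             Picks a b l l′ → Picks a b r r′ → Picks a b (node l r) (node l′ r′)

  picks : ∀ a b t → Picks a b t (pick a b t)
  picks a b (leaf z)                   = leaf
  picks a b (node (leaf u) (leaf v))   = picks-leaves (siblings? a b u v)
    where
    picks-leaves : (s? : Dec (Siblings a b u v)) →
      Picks a b (node (leaf u) (leaf v)) (if does s? then leaf b else node (leaf u) (leaf v))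
    picks-leaves (yes s) = cherry s
    picks-leaves (no ¬s) = node (λ { refl refl → ¬s }) leaf leaf
  picks a b (node (leaf u) (node l r)) = node (λ _ ()) leaf (picks a b (node l r))
  picks a b (node (node l₁ l₂) r)      = node (λ ()) (picks a b (node l₁ l₂)) (picks a b r)

  Picks-¬Cherry : Picks a b t t′ → ¬ Cherry a b t → t′ ≡ t
  Picks-¬Cherry leaf           _  = refl
  Picks-¬Cherry (cherry s)     ¬c = ⊥-elim (¬c (cherry s))
  Picks-¬Cherry (node _ pl pr) ¬c =
    cong₂ node (Picks-¬Cherry pl (¬c ∘ left)) (Picks-¬Cherry pr (¬c ∘ right))

  pick-¬Cherry : ¬ Cherry a b t → pick a b t ≡ t
  pick-¬Cherry {a} {b} {t} = Picks-¬Cherry (picks a b t)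

  Picks-Cherry : ¬ Siblings x y a b → Picks a b t t′ → Cherry x y t → Cherry x y t′
  Picks-Cherry ¬s (cherry s′)         (cherry s) = ⊥-elim (¬s (Siblings-trans s s′))
  Picks-Cherry ¬s (node _ leaf leaf)  (cherry s) = cherry s
  Picks-Cherry ¬s (node _ pl _)       (left c)   = left (Picks-Cherry ¬s pl c)
  Picks-Cherry ¬s (node _ _ pr)       (right c)  = right (Picks-Cherry ¬s pr c)

  apply-Cherry : ∀ L → (∀ {a b} → (a , just b) ∈ L → ¬ Siblings x y a b) →
    Cherry x y t → Cherry x y (apply L t)
  apply-Cherry []                 _  c = c
  apply-Cherry ((a , just b) ∷ L) ok c = apply-Cherry L (ok ∘ there) (Picks-Cherry (ok (here refl)) (picks a b _) c)
  apply-Cherry ((a , nothing) ∷ L) ok c = apply-Cherry L (ok ∘ there) c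

  Picks-leaves : Picks a b t t′ → leaves t′ ⊆ leaves t
  Picks-leaves leaf                         = id
  Picks-leaves (cherry (inj₁ (refl , refl))) = there
  Picks-leaves (cherry (inj₂ (refl , refl))) = ∈-++⁺ˡ
  Picks-leaves (node _ pl pr)               = ++⁺ (Picks-leaves pl) (Picks-leaves pr)

  apply-leaves : ∀ L t → leaves (apply L t) ⊆ leaves t
  apply-leaves []                 t = id
  apply-leaves ((a , just b) ∷ L) t = Picks-leaves (picks a b t) ∘ apply-leaves L (pick a b t)
  apply-leaves ((a , nothing) ∷ L) t = apply-leaves L t

  apply-++ : ∀ (A B : Seq {n}) t → apply (A ++ B) t ≡ apply B (apply A t)
  apply-++ []                 B t = refl
  apply-++ ((a , just b) ∷ A) B t = apply-++ A B (pick a b t)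
  apply-++ ((a , nothing) ∷ A) B t = apply-++ A B t

  Distinct : Tree {n} → Set
  Distinct (leaf _)   = ⊤
  Distinct (node l r) = Distinct l × Distinct r × Disjoint (leaves l) (leaves r)

  Unique⇒Distinct : ∀ t → Unique (leaves t) → Distinct t
  Unique⇒Distinct (leaf _)   _ = _
  Unique⇒Distinct (node l r) u with AllPairs-++⁻ (leaves l) u
  ... | ul , ur , cross =
    Unique⇒Distinct l ul , Unique⇒Distinct r ur ,
    λ (c∈l , c∈r) → All.lookup (All.lookup cross c∈l) c∈r refl

  Picks-Distinct : Picks a b t t′ → Distinct t → Distinct t′
  Picks-Distinct leaf           _                = _
  Picks-Distinct (cherry _)     _                = _
  Picks-Distinct (node _ pl pr) (dl , dr , disj) =
    Picks-Distinct pl dl , Picks-Distinct pr dr ,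
    λ (c∈l′ , c∈r′) → disj (Picks-leaves pl c∈l′ , Picks-leaves pr c∈r′)

  apply-Distinct : ∀ L t → Distinct t → Distinct (apply L t)
  apply-Distinct []                  t d = d
  apply-Distinct ((a , just b) ∷ L)  t d = apply-Distinct L (pick a b t) (Picks-Distinct (picks a b t) d)
  apply-Distinct ((a , nothing) ∷ L) t d = apply-Distinct L t d

  Cherry⇒≢ : Distinct t → Cherry x y t → x ≢ y
  Cherry⇒≢ (_ , _ , disj) (cherry (inj₁ (refl , refl))) refl = disj (here refl , here refl)
  Cherry⇒≢ (_ , _ , disj) (cherry (inj₂ (refl , refl))) refl = disj (here refl , here refl)
  Cherry⇒≢ (dl , _ , _)   (left c)                            = Cherry⇒≢ dl c
  Cherry⇒≢ (_ , dr , _)   (right c)                           = Cherry⇒≢ dr c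

  Picks-removes : Distinct t → Cherry x y t → Picks x y t t′ → x ∉ leaves t′
  Picks-removes d              c          (cherry _)         (here x≡y) = Cherry⇒≢ d c x≡y
  Picks-removes _              (cherry s) (node nc leaf leaf) _          = nc refl refl s
  Picks-removes (dl , _ , disj) (left c)  (node _ pl pr)     x∈         with ∈-++⁻ _ x∈
  ... | inj₁ x∈l′ = Picks-removes dl c pl x∈l′
  ... | inj₂ x∈r′ = disj (Cherry⇒∈leaves c , Picks-leaves pr x∈r′)
  Picks-removes {t = node l _} (_ , dr , disj) (right c) (node _ pl pr) x∈ with ∈-++⁻ _ x∈
  ... | inj₁ x∈l′ = disj (Picks-leaves pl x∈l′ , Cherry⇒∈leaves c)
  ... | inj₂ x∈r′ = Picks-removes dr c pr x∈r′

  data Pruned (F : List (Fin n)) : Tree {n} → Tree {n} → Set where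
    leaf  : Pruned F (leaf z) (leaf z)
    node  : Pruned F l′ l → Pruned F r′ r → Pruned F (node l′ r′) (node l r)
    dropˡ : leaves l ⊆ F → Pruned F t′ r → Pruned F t′ (node l r)
    dropʳ : leaves r ⊆ F → Pruned F t′ l → Pruned F t′ (node l r)

  Pruned-refl : ∀ t → Pruned F t t
  Pruned-refl (leaf _)   = leaf
  Pruned-refl (node l r) = node (Pruned-refl l) (Pruned-refl r)

  Pruned-mono : ∀ {G} → F ⊆ G → Pruned F t′ t → Pruned G t′ t
  Pruned-mono F⊆G leaf          = leaf
  Pruned-mono F⊆G (node p q)    = node (Pruned-mono F⊆G p) (Pruned-mono F⊆G q)
  Pruned-mono F⊆G (dropˡ ⊆F p) = dropˡ (F⊆G ∘ ⊆F) (Pruned-mono F⊆G p)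
  Pruned-mono F⊆G (dropʳ ⊆F p) = dropʳ (F⊆G ∘ ⊆F) (Pruned-mono F⊆G p)

  Pruned-leaf-leaves : Pruned F (leaf z) t → leaves t ⊆ z ∷ F
  Pruned-leaf-leaves leaf         = ∈-++⁺ˡ
  Pruned-leaf-leaves (dropˡ ⊆F p) = [ there ∘ ⊆F , Pruned-leaf-leaves p ]′ ∘ ∈-++⁻ _
  Pruned-leaf-leaves (dropʳ ⊆F p) = [ Pruned-leaf-leaves p , there ∘ ⊆F ]′ ∘ ∈-++⁻ _

  Pruned-to-leaf : Pruned F t′ (leaf z) → t′ ≡ leaf z
  Pruned-to-leaf leaf = refl

  Picks-Pruned : Picks a b t′ t″ → Pruned F t′ t → Pruned (a ∷ F) t″ t
  Picks-Pruned leaf                          leaf         = leaf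
  Picks-Pruned (cherry (inj₁ (refl , refl))) (node p q)   = dropˡ (Pruned-leaf-leaves p) (Pruned-mono there q)
  Picks-Pruned (cherry (inj₂ (refl , refl))) (node p q)   = dropʳ (Pruned-leaf-leaves q) (Pruned-mono there p)
  Picks-Pruned (node _ pl pr)                (node p q)   = node (Picks-Pruned pl p) (Picks-Pruned pr q)
  Picks-Pruned pk                            (dropˡ ⊆F p) = dropˡ (there ∘ ⊆F) (Picks-Pruned pk p)
  Picks-Pruned pk                            (dropʳ ⊆F p) = dropʳ (there ∘ ⊆F) (Picks-Pruned pk p)

  Picks-Pruned-both : b ∉ F → Picks a b t′ t″ → Picks a b t s → Pruned F t′ t → Pruned (a ∷ F) t″ s
  Picks-Pruned-both b∉F leaf          leaf       leaf             = leaf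
  Picks-Pruned-both b∉F (cherry _)    (cherry _) (node leaf leaf) = leaf
  Picks-Pruned-both b∉F (node nc _ _) (cherry s) (node leaf leaf) = ⊥-elim (nc refl refl s)
  Picks-Pruned-both b∉F (cherry (inj₁ (refl , refl))) (node _ pl pr) (node p q) =
    dropˡ (Pruned-leaf-leaves p ∘ Picks-leaves pl) (Picks-Pruned-both b∉F leaf pr q)
  Picks-Pruned-both b∉F (cherry (inj₂ (refl , refl))) (node _ pl pr) (node p q) =
    dropʳ (Pruned-leaf-leaves q ∘ Picks-leaves pr) (Picks-Pruned-both b∉F leaf pl p)
  Picks-Pruned-both b∉F (node _ pl′ pr′) (node _ pl pr) (node p q) =
    node (Picks-Pruned-both b∉F pl′ pl p) (Picks-Pruned-both b∉F pr′ pr q)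
  Picks-Pruned-both b∉F leaf (cherry (inj₁ (refl , refl))) (dropˡ _   leaf) = leaf
  Picks-Pruned-both b∉F leaf (cherry (inj₂ (refl , refl))) (dropˡ b∈F leaf) = ⊥-elim (b∉F (b∈F (here refl)))
  Picks-Pruned-both b∉F leaf (cherry (inj₁ (refl , refl))) (dropʳ b∈F leaf) = ⊥-elim (b∉F (b∈F (here refl)))
  Picks-Pruned-both b∉F leaf (cherry (inj₂ (refl , refl))) (dropʳ _   leaf) = leaf
  Picks-Pruned-both b∉F pk′ (node _ pl pr) (dropˡ ⊆F p) =
    dropˡ (there ∘ ⊆F ∘ Picks-leaves pl) (Picks-Pruned-both b∉F pk′ pr p)
  Picks-Pruned-both b∉F pk′ (node _ pl pr) (dropʳ ⊆F p) =
    dropʳ (there ∘ ⊆F ∘ Picks-leaves pr) (Picks-Pruned-both b∉F pk′ pl p)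

  CanPrecede : Rel (Elem {n}) 0ℓ
  CanPrecede e e′ = proj₂ e′ ≢ just (proj₁ e)

  apply-Pruned : ∀ L → AllPairs CanPrecede L → (∀ {a b} → (a , just b) ∈ L → b ∉ F) →
    Pruned F t′ t → Pruned (map proj₁ L ++ F) (apply L t′) (apply L t)
  apply-Pruned []                  _         _     p = p
  apply-Pruned {F} {t′} {t} ((a , just b) ∷ L) (ra ∷ rL) fresh p =
    Pruned-mono (∈-resp-↭ (shift a (map proj₁ L) F))
      (apply-Pruned L rL fresh′ (Picks-Pruned-both (fresh (here refl)) (picks a b t′) (picks a b t) p))
    where
    fresh′ : ∀ {a′ b′} → (a′ , just b′) ∈ L → b′ ∉ a ∷ F
    fresh′ m (here b′≡a)  = All.lookup ra m (cong just b′≡a)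
    fresh′ m (there b′∈F) = fresh (there m) b′∈F
  apply-Pruned ((a , nothing) ∷ L) (_ ∷ rL)  fresh p =
    Pruned-mono there (apply-Pruned L rL (fresh ∘ there) p)

  hoist-apply : ∀ pre post {U} → Distinct U →
    AllPairs CanPrecede (pre ++ (x , just y) ∷ post) → All (CanPrecede (x , just y)) pre →
    (Cherry x y (apply pre U) → Cherry x y U) →
    apply (pre ++ (x , just y) ∷ post) U ≡ leaf z → apply ((x , just y) ∷ pre ++ post) U ≡ leaf z
  hoist-apply {x} {y} {z} pre post {U} d tc pre-ok not-created reaches with cherry? x y U
  ... | no ¬c = begin
    apply (pre ++ post) (pick x y U)     ≡⟨ cong (apply (pre ++ post)) (pick-¬Cherry ¬c) ⟩
    apply (pre ++ post) U                ≡⟨ apply-++ pre post U ⟩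
    apply post (apply pre U)             ≡⟨ cong (apply post) (pick-¬Cherry (¬c ∘ not-created)) ⟨
    apply post (pick x y (apply pre U))  ≡⟨ apply-++ pre _ U ⟨
    apply (pre ++ (x , just y) ∷ post) U ≡⟨ reaches ⟩
    leaf z                               ∎
    where open ≡-Reasoning
  ... | yes c = Pruned-to-leaf (subst₂ (Pruned _) picked-first reaches
                  (apply-Pruned _ tc x-fresh (Picks-Pruned (picks x y U) (Pruned-refl U))))
    where
    open ≡-Reasoning
    V : Tree {n}
    V = pick x y U
    x-gone : x ∉ leaves (apply pre V)
    x-gone = Picks-removes d c (picks x y U) ∘ apply-leaves pre V
    picked-first : apply (pre ++ (x , just y) ∷ post) V ≡ apply (pre ++ post) V
    picked-first = begin
      apply (pre ++ (x , just y) ∷ post) V ≡⟨ apply-++ pre _ V ⟩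
      apply post (pick x y (apply pre V))  ≡⟨ cong (apply post) (pick-¬Cherry (x-gone ∘ Cherry⇒∈leaves)) ⟩
      apply post (apply pre V)             ≡⟨ apply-++ pre post V ⟨
      apply (pre ++ post) V                ∎
    x-fresh : ∀ {a b} → (a , just b) ∈ pre ++ (x , just y) ∷ post → b ∉ x ∷ []
    x-fresh m (here b≡x) with ∈-++⁻ pre m
    ... | inj₁ m∈pre         = All.lookup pre-ok m∈pre (cong just b≡x)
    ... | inj₂ (here refl)   = Cherry⇒≢ d c (sym b≡x)
    ... | inj₂ (there m∈post) =
      All.lookup (AllPairs.head (proj₁ (proj₂ (AllPairs-++⁻ pre tc)))) m∈post (cong just b≡x)

  cherry-not-created : ∀ (A B : Seq {n}) 𝒯 → (∀ {a b} → (a , just b) ∈ B → ¬ Siblings x y a b) →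
    count x y (applyAll A 𝒯) ≡ count x y (applyAll (A ++ B) 𝒯) →
    ∀ {T} → T ∈ 𝒯 → Cherry x y (apply B (apply A T)) → Cherry x y (apply A T)
  cherry-not-created {x} {y} A B 𝒯 B-keeps same-count T∈ =
    isCherry⇒Cherry
    ∘ filter-map-length-≡⇒⊇ (λ T → isCherry x y T Bool.≟ true) (apply A) (apply (A ++ B)) 𝒯 kept same-count T∈
    ∘ Cherry⇒isCherry ∘ subst (Cherry x y) (sym (apply-++ A B _))
    where
    kept : ∀ {T} → T ∈ 𝒯 → isCherry x y (apply A T) ≡ true → isCherry x y (apply (A ++ B) T) ≡ true
    kept {T} _ =
      Cherry⇒isCherry ∘ subst (Cherry x y) (sym (apply-++ A B T)) ∘ apply-Cherry B B-keeps ∘ isCherry⇒Cherry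

  pairE∉singles : ∀ π (qs : List (Fin n)) → pairE π ∉ map singleE qs
  pairE∉singles π qs m with ∈-map⁻ singleE m
  ... | _ , _ , ()

  Shape-uncons : ∀ {e L ps qs} π → pairE π ∈ e ∷ L → Shape (e ∷ L) ps qs →
    ∃₂ λ p ps₀ → ps ≡ p ∷ ps₀ × pairE p ≡ e × Shape L ps₀ qs
  Shape-uncons {ps = []}     π π∈ sh = ⊥-elim (pairE∉singles π _ (subst (pairE π ∈_) sh π∈))
  Shape-uncons {ps = p ∷ ps} π π∈ sh with ∷-injective sh
  ... | e≡ , sh₀ = p , ps , refl , sym e≡ , sh₀

  Shape-hoist : ∀ A B π C {ps qs} → Shape (A ++ B ++ pairE π ∷ C) ps qs →
    ∃ λ ps′ → Shape (A ++ pairE π ∷ B ++ C) ps′ qs × length ps′ ≡ length ps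
  Shape-hoist []      []      π C sh = _ , sh , refl
  Shape-hoist []      (b ∷ B) π C {ps} sh with Shape-uncons {ps = ps} π (there (∈-++⁺ʳ B (here refl))) sh
  ... | p , ps₀ , refl , refl , sh₀ with Shape-hoist [] B π C {ps₀} sh₀
  ... | ps₀′ , sh₀′ , len with Shape-uncons {ps = ps₀′} π (here refl) sh₀′
  ... | _ , ps₀″ , refl , _ , sh₀″ =
    π ∷ p ∷ ps₀″ , cong (λ L → pairE π ∷ pairE p ∷ L) sh₀″ , cong suc len
  Shape-hoist (a ∷ A) B       π C {ps} sh
    with Shape-uncons {ps = ps} π (there (∈-++⁺ʳ A (∈-++⁺ʳ B (here refl)))) sh
  ... | p , ps₀ , refl , refl , sh₀ with Shape-hoist A B π C {ps₀} sh₀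
  ... | ps₀′ , sh₀′ , len = p ∷ ps₀′ , cong (pairE p ∷_) sh₀′ , cong suc len

  hoist-↭ : ∀ (A B : Seq {n}) e C → A ++ B ++ e ∷ C ↭ A ++ e ∷ B ++ C
  hoist-↭ A B e C = ++⁺ˡ A (shift e B C)

  TreeChild⇒AllPairs : ∀ {L} → TreeChild L → AllPairs CanPrecede L
  TreeChild⇒AllPairs {L} (_ , _ , _ , _ , tc) = lookup⇒AllPairs L tc

  hoist-TreeChild : ∀ A B π C → All (CanPrecede (pairE π)) B →
    TreeChild (A ++ B ++ pairE π ∷ C) → TreeChild (A ++ pairE π ∷ B ++ C)
  hoist-TreeChild A B π C B-ok tc@(ps , qs , sh , len , _) with Shape-hoist A B π C {ps} sh
  ... | ps′ , sh′ , len′ =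
    ps′ , qs , sh′ ,
    subst₂ _≤ℕ_ (↭-length (hoist-↭ A B _ C)) (cong suc (sym len′)) len ,
    AllPairs⇒lookup (AllPairs-hoist A B B-ok (TreeChild⇒AllPairs tc))

  hoist-IsCPS : ∀ 𝒯 A B π C →
    (∀ {T z} → T ∈ 𝒯 → apply (B ++ pairE π ∷ C) (apply A T) ≡ leaf z →
                        apply (pairE π ∷ B ++ C) (apply A T) ≡ leaf z) →
    IsCPS 𝒯 (A ++ B ++ pairE π ∷ C) → IsCPS 𝒯 (A ++ pairE π ∷ B ++ C)
  hoist-IsCPS 𝒯 A B π C reaches (ps , qs , sh , lt , covers , ends) with Shape-hoist A B π C {ps} sh
  ... | ps′ , sh′ , len′ =
    ps′ , qs , sh′ ,
    subst₂ _<_ (sym len′) (↭-length (hoist-↭ A B _ C)) lt ,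
    (λ a → ∈-resp-↭ (↭.map⁺ proj₁ (hoist-↭ A B _ C)) (covers a)) ,
    λ T T∈ → let z , T/S≡z , z∈qs = ends T T∈ in
      z , trans (apply-++ A _ T) (reaches T∈ (trans (sym (apply-++ A _ T)) T/S≡z)) , z∈qs

  weight-hoist : ∀ (A B : Seq {n}) e C → weight (A ++ e ∷ B ++ C) ≡ weight (A ++ B ++ e ∷ C)
  weight-hoist A B e C = cong (_⊖ n) (sym (↭-length (hoist-↭ A B e C)))

proposition22 : (n : ℕ) (𝒯 : List (Tree {n})) →
    (∀ T → T ∈ 𝒯 → IsPhyloXTree T) →
    (S S' : Seq {n}) →
    TreeChild (S ++ S') → IsCPS 𝒯 (S ++ S') →
    (x y : Fin n) → Dominated 𝒯 S S' x y →
    Σ (Seq {n}) λ S'' →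
      TreeChild (S ++ (x , just y) ∷ S'') × IsCPS 𝒯 (S ++ (x , just y) ∷ S'') ×
      weight (S ++ (x , just y) ∷ S'') ≤ weight (S ++ S')
proposition22 n 𝒯 phylo S _ tc cps x y (pre , post , refl , _ , same-count , pre-ok) =
  pre ++ post ,
  hoist-TreeChild S pre (x , y) post x-free tc ,
  hoist-IsCPS 𝒯 S pre (x , y) post reaches cps ,
  ≤-reflexive (weight-hoist S pre _ post)
  where
  x-free : All (CanPrecede (x , just y)) pre
  x-free = All.tabulate λ { {_ , just b} m → proj₁ (pre-ok _ b m) ∘ just-injective ; {_ , nothing} _ () }
  keeps-cherry : ∀ {a b} → (a , just b) ∈ pre → ¬ Siblings x y a b
  keeps-cherry m = [ proj₁ (proj₂ (pre-ok _ _ m)) , proj₂ (proj₂ (pre-ok _ _ m)) ]′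
  reaches : ∀ {T z} → T ∈ 𝒯 → apply (pre ++ (x , just y) ∷ post) (apply S T) ≡ leaf z →
                               apply ((x , just y) ∷ pre ++ post) (apply S T) ≡ leaf z
  reaches T∈ = hoist-apply pre post (apply-Distinct S _ (Unique⇒Distinct _ (proj₁ (phylo _ T∈))))
    (proj₁ (proj₂ (AllPairs-++⁻ S (TreeChild⇒AllPairs tc)))) x-free
    (cherry-not-created S pre 𝒯 keeps-cherry same-count T∈)
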